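{- Let $\mathbb{F}_4=\mathbb{F}_2[X]/(X^2+X+1)=\{\bar0,\bar1,X,X+\bar1\}$ be the field with four elements (where $X$ denotes the class of the indeterminate). Up to cyclic permutations, the irreducible $\lambda$-quiddities over $\mathbb{F}_4$ are exactly: - $(\bar1,\bar1,\bar1)$; - $(\bar0,\bar0,\bar0,\bar0)$, $(\bar0,X,\bar0,X)$, $(\bar0,X+\bar1,\bar0,X+\bar1)$; - $(X,X,X,X,X)$, $(X+\bar1,X+\bar1,X+\bar1,X+\bar1,X+\bar1)$; - $(X,X+\bar1,X,X+\bar1,X,X+\bar1)$; - $(X,X,X+\bar1,X+\bar1,X,X,X+\bar1,X+\bar1)$; - $(X,X,X+\bar1,X,X,X+\bar1,X,X,X+\bar1)$ and $(X+\bar1,X+\bar1,X,X+\bar1,X+\bar1,X,X+\bar1,X+\bar1,X)$.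
   Context: For a commutative unital ring $A$ and $a_1,\ldots,a_n\in A$, set $M_n(a_1,\ldots,a_n)=\begin{pmatrix}a_n&-1\\1&0\end{pmatrix}\cdots\begin{pmatrix}a_1&-1\\1&0\end{pmatrix}$. An $n$-tuple $(a_1,\ldots,a_n)\in A^n$ is a $\lambda$-quiddity over $A$ of size $n$ if $M_n(a_1,\ldots,a_n)=\pm Id$. For $(a_1,\ldots,a_n)\in A^n$, $(b_1,\ldots,b_m)\in A^m$ define $(a_1,\ldots,a_n)\oplus(b_1,\ldots,b_m)=(a_1+b_m,a_2,\ldots,a_{n-1},a_n+b_1,b_2,\ldots,b_{m-1})$. Write $(a_1,\ldots,a_n)\sim(b_1,\ldots,b_n)$ if $(b_1,\ldots,b_n)$ is obtained by a cyclic permutation of $(a_1,\ldots,a_n)$ or of $(a_n,\ldots,a_1)$. A $\lambda$-quiddity $(c_1,\ldots,c_n)$ with $n\ge3$ is reducible if there exist a $\lambda$-quiddity $(b_1,\ldots,b_l)$ and $(a_1,\ldots,a_m)\in A^m$ with $m,l\ge3$ and $(c_1,\ldots,c_n)\sim(a_1,\ldots,a_m)\oplus(b_1,\ldots,b_l)$; otherwise it is irreducible. The tuple $(0,0)$ is considered reducible. -}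

module Defs where

open import Data.Bool using (Bool; true; false; _xor_; _∧_)
open import Data.Nat using (ℕ; zero; suc; _≤_)
open import Data.List using (List; []; _∷_; _++_; [_]; length; reverse)
open import Data.Product using (_×_; _,_; Σ; ∃; ∃-syntax)
open import Data.Sum using (_⊎_)
open import Relation.Binary.PropositionalEquality using (_≡_)
open import Relation.Nullary using (¬_)

-- The field F4 = F2[X]/(X^2+X+1): the element  a + b·X  is  mk a b
-- (a, b ∈ F2 = Bool, with xor as addition and ∧ as multiplication).

record F4 : Set where
  constructor mk
  field
    c0 : Bool
    c1 : Bool

infixl 6 _+F_
infixl 7 _*F_

_+F_ : F4 → F4 → F4
mk a b +F mk c d = mk (a xor c) (b xor d)

-- (a + bX)(c + dX) = ac + (ad + bc)X + bd X²,  and X² = X + 1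
_*F_ : F4 → F4 → F4
mk a b *F mk c d = mk ((a ∧ c) xor (b ∧ d)) (((a ∧ d) xor (b ∧ c)) xor (b ∧ d))

-F_ : F4 → F4
-F mk a b = mk a b   -- characteristic 2

0̄ 1̄ X X+1̄ : F4
0̄   = mk false false
1̄   = mk true  false
X   = mk false true
X+1̄ = mk true  true

record Mat2 : Set where
  constructor mat
  field
    m11 m12 m21 m22 : F4

_⊗_ : Mat2 → Mat2 → Mat2
mat a b c d ⊗ mat e f g h =
  mat (a *F e +F b *F g) (a *F f +F b *F h) (c *F e +F d *F g) (c *F f +F d *F h)

Id : Mat2
Id = mat 1̄ 0̄ 0̄ 1̄

-Id : Mat2
-Id = mat (-F 1̄) 0̄ 0̄ (-F 1̄)

M : F4 → Mat2
M a = mat a (-F 1̄) 1̄ 0̄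

Mₙ : List F4 → Mat2
Mₙ []       = Id
Mₙ (a ∷ as) = Mₙ as ⊗ M a

IsλQuiddity : List F4 → Set
IsλQuiddity c = Mₙ c ≡ Id ⊎ Mₙ c ≡ -Id

private
  last' : F4 → List F4 → F4
  last' x []       = x
  last' x (y ∷ ys) = last' y ys

  init' : F4 → List F4 → List F4
  init' x []       = []
  init' x (y ∷ ys) = x ∷ init' y ys

-- (a₁,…,a_m) ⊕ (b₁,…,b_l) = (a₁+b_l, a₂,…,a_{m-1}, a_m+b₁, b₂,…,b_{l-1})
-- (only used for m, l ≥ 3; the fallback clause is irrelevant)
_⊕_ : List F4 → List F4 → List F4
(a₁ ∷ a₂ ∷ as) ⊕ (b₁ ∷ b₂ ∷ bs) =
  (a₁ +F last' b₂ bs) ∷ (init' a₂ as ++ ((last' a₂ as +F b₁) ∷ init' b₂ bs))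
_ ⊕ _ = []

-- rotate k (a₁,…,a_n) = (a_{k+1},…,a_n,a₁,…,a_k)   (k taken mod n)
rotate : ℕ → List F4 → List F4
rotate zero    xs       = xs
rotate (suc k) []       = []
rotate (suc k) (x ∷ xs) = rotate k (xs ++ [ x ])

_∼_ : List F4 → List F4 → Set
a ∼ b = ∃[ k ] (b ≡ rotate k a ⊎ b ≡ rotate k (reverse a))

IsReducible : List F4 → Set
IsReducible c =
  (c ≡ 0̄ ∷ 0̄ ∷ [])   -- convention: (0,0) is reducible
  ⊎ (3 ≤ length c × ∃[ a ] ∃[ b ]
       (3 ≤ length a × 3 ≤ length b × IsλQuiddity b × c ∼ (a ⊕ b)))

IsIrreducibleλQuiddity : List F4 → Set
IsIrreducibleλQuiddity c = IsλQuiddity c × 3 ≤ length c × ¬ IsReducible c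

irreducibleList : List (List F4)
irreducibleList =
    (1̄ ∷ 1̄ ∷ 1̄ ∷ [])
  ∷ (0̄ ∷ 0̄ ∷ 0̄ ∷ 0̄ ∷ [])
  ∷ (0̄ ∷ X ∷ 0̄ ∷ X ∷ [])
  ∷ (0̄ ∷ X+1̄ ∷ 0̄ ∷ X+1̄ ∷ [])
  ∷ (X ∷ X ∷ X ∷ X ∷ X ∷ [])
  ∷ (X+1̄ ∷ X+1̄ ∷ X+1̄ ∷ X+1̄ ∷ X+1̄ ∷ [])
  ∷ (X ∷ X+1̄ ∷ X ∷ X+1̄ ∷ X ∷ X+1̄ ∷ [])
  ∷ (X ∷ X ∷ X+1̄ ∷ X+1̄ ∷ X ∷ X ∷ X+1̄ ∷ X+1̄ ∷ [])
  ∷ (X ∷ X ∷ X+1̄ ∷ X ∷ X ∷ X+1̄ ∷ X ∷ X ∷ X+1̄ ∷ [])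
  ∷ (X+1̄ ∷ X+1̄ ∷ X ∷ X+1̄ ∷ X+1̄ ∷ X ∷ X+1̄ ∷ X+1̄ ∷ X ∷ [])
  ∷ []

module Submission where

-- Over F4 the sum (a₁,…,a_m) ⊕ (b₁,…,b_l) can be undone once b is known: a₁ and a_m are
-- recovered from the sum by adding b_l and b₁ back (characteristic 2).  Hence a λ-quiddity c
-- is reducible exactly when a rotation of c or of its reversal has the form P ++ (b₂,…,b_{l-1})
-- with |P| ≥ 3 and (b₁,…,b_l) a λ-quiddity.  Twenty λ-quiddities b make every word of length
-- 10 reducible in this way, so a finite search over words, pruned at such factors, shows that
-- every irreducible λ-quiddity is a rotation of a listed one.  Conversely no rotation of a
-- listed tuple or of its reversal has such a split, which is again a finite check.

open import Defs
open import Data.Bool using (Bool; true; false; T; _∨_; _∧_; _xor_)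
open import Data.Bool.ListAction using (all)
open import Data.Bool.Properties using (T-∨; T-∧; T-≡; xor-assoc; xor-same; xor-identityʳ) renaming (_≟_ to _≟B_)
open import Data.List using (List; []; _∷_; _++_; [_]; _∷ʳ_; length; reverse; drop; take; upTo; initLast; _∷ʳ′_)
open import Data.List.Properties using (≡-dec; ++-assoc; ++-identityʳ; length-++; length-++-≤ˡ; reverse-++; unfold-reverse; length-reverse)
open import Data.List.Membership.Propositional using (_∈_; find)
open import Data.List.Membership.Propositional.Properties using (∈-upTo⁺)
open import Data.List.Relation.Unary.All as All using (All; all?)
open import Data.List.Relation.Unary.All.Properties using (all⁺)
open import Data.List.Relation.Unary.Any as Any using (Any; here; there; any?)
open import Data.List.Relation.Binary.Infix.Heterogeneous using (Infix; MkView; toView)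
open import Data.List.Relation.Binary.Infix.Heterogeneous.Properties using (infix?)
open import Data.List.Relation.Binary.Pointwise using (Pointwise-≡⇒≡)
open import Data.Nat using (ℕ; NonZero; zero; suc; _+_; _*_; _≤_; _<_; z≤n; s≤s; z<s; _≤?_; _<?_; _%_; _/_; >-nonZero)
open import Data.Nat.Properties using (m<m+n; +-comm; +-assoc; +-cancelˡ-≤; ≤-trans; <⇒≱; module ≤-Reasoning)
open import Data.Nat.DivMod using (m≡m%n+[m/n]*n; m%n<n)
open import Data.Product using (_×_; _,_; ∃-syntax)
open import Data.Sum using (_⊎_; inj₁; inj₂; [_,_]′; reduce)
open import Function using (_∘_)
open import Function.Bundles using (Equivalence)
open import Relation.Binary.Definitions using (DecidableEquality)
open import Relation.Binary.PropositionalEquality using (_≡_; _≢_; refl; sym; trans; cong; cong₂; subst; module ≡-Reasoning)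
open import Relation.Nullary using (¬_; Dec; contradiction)
open import Relation.Nullary.Decidable using (map′; _×-dec_; _⊎-dec_; _→-dec_; ¬?; ⌊_⌋; toWitness)
open import Relation.Unary using (Decidable)

_≟F_ : DecidableEquality F4
mk a b ≟F mk c d =
  map′ (λ { (refl , refl) → refl }) (λ { refl → refl , refl }) (a ≟B c ×-dec b ≟B d)

_≟M_ : DecidableEquality Mat2
mat a b c d ≟M mat e f g h =
  map′ (λ { (refl , refl , refl , refl) → refl }) (λ { refl → refl , refl , refl , refl })
       (a ≟F e ×-dec b ≟F f ×-dec c ≟F g ×-dec d ≟F h)

-- In characteristic 2 the matrix -Id is Id itself.
isλQuiddity? : Decidable IsλQuiddity
isλQuiddity? c = map′ inj₁ reduce (Mₙ c ≟M Id)

-- Agda checks ⌊ a? ⌋ ≡ true by refl much faster than True a? by tt.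
fromYes : ∀ {A : Set} (a? : Dec A) → ⌊ a? ⌋ ≡ true → A
fromYes a? isYes = toWitness (Equivalence.from T-≡ isYes)

+F-cancelʳ : ∀ x y → (x +F y) +F y ≡ x
+F-cancelʳ (mk a b) (mk c d) = cong₂ mk (xor-cancelʳ a c) (xor-cancelʳ b d)
  where
  xor-cancelʳ : ∀ a c → (a xor c) xor c ≡ a
  xor-cancelʳ a c = trans (xor-assoc a c c) (trans (cong (a xor_) (xor-same c)) (xor-identityʳ a))

F4-elements : List F4
F4-elements = 0̄ ∷ 1̄ ∷ X ∷ X+1̄ ∷ []

∈-F4-elements : ∀ x → x ∈ F4-elements
∈-F4-elements (mk false false) = here refl
∈-F4-elements (mk true  false) = there (here refl)
∈-F4-elements (mk false true)  = there (there (here refl))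
∈-F4-elements (mk true  true)  = there (there (there (here refl)))

length-∷ʳ : ∀ {A : Set} (xs : List A) x → length (xs ∷ʳ x) ≡ suc (length xs)
length-∷ʳ xs x = trans (length-++ xs) (+-comm (length xs) 1)

length-ends : ∀ {A : Set} (x x′ : A) q y y′ → length (x ∷ (q ∷ʳ y)) ≡ length (x′ ∷ (q ∷ʳ y′))
length-ends x x′ q y y′ = cong suc (trans (length-∷ʳ q y) (sym (length-∷ʳ q y′)))

drop-length-++ : ∀ {A : Set} (xs ys : List A) → drop (length xs) (xs ++ ys) ≡ ys
drop-length-++ []       ys = refl
drop-length-++ (x ∷ xs) ys = drop-length-++ xs ys

infix⇒split : ∀ {A : Set} {I w : List A} → Infix _≡_ I w → ∃[ u ] ∃[ v ] (w ≡ u ++ I ++ v)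
infix⇒split occurs with toView occurs
... | MkView u I≡ v with Pointwise-≡⇒≡ I≡
...   | refl = u , v , refl

rotate-[] : ∀ k → rotate k [] ≡ []
rotate-[] zero    = refl
rotate-[] (suc k) = refl

rotate-++ : ∀ u w → rotate (length u) (u ++ w) ≡ w ++ u
rotate-++ []      w = sym (++-identityʳ w)
rotate-++ (x ∷ u) w = begin
  rotate (length u) ((u ++ w) ++ [ x ]) ≡⟨ cong (rotate (length u)) (++-assoc u w [ x ]) ⟩
  rotate (length u) (u ++ w ∷ʳ x)       ≡⟨ rotate-++ u (w ∷ʳ x) ⟩
  (w ∷ʳ x) ++ u                         ≡⟨ ++-assoc w [ x ] u ⟩
  w ++ x ∷ u                            ∎
  where open ≡-Reasoning

rotate-+ : ∀ i j xs → rotate (i + j) xs ≡ rotate j (rotate i xs)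
rotate-+ zero    j xs       = refl
rotate-+ (suc i) j []       = sym (rotate-[] j)
rotate-+ (suc i) j (x ∷ xs) = rotate-+ i j (xs ∷ʳ x)

length-rotate : ∀ k xs → length (rotate k xs) ≡ length xs
length-rotate zero    xs       = refl
length-rotate (suc k) []       = refl
length-rotate (suc k) (x ∷ xs) = trans (length-rotate k (xs ∷ʳ x)) (length-∷ʳ xs x)

rotate-length : ∀ xs → rotate (length xs) xs ≡ xs
rotate-length xs = subst (λ ys → rotate (length xs) ys ≡ xs) (++-identityʳ xs) (rotate-++ xs [])

rotate-*-length : ∀ d xs → rotate (d * length xs) xs ≡ xs
rotate-*-length zero    xs = refl
rotate-*-length (suc d) xs = begin
  rotate (length xs + d * length xs) xs        ≡⟨ rotate-+ (length xs) (d * length xs) xs ⟩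
  rotate (d * length xs) (rotate (length xs) xs) ≡⟨ cong (rotate (d * length xs)) (rotate-length xs) ⟩
  rotate (d * length xs) xs                      ≡⟨ rotate-*-length d xs ⟩
  xs                                             ∎
  where open ≡-Reasoning

rotate-% : ∀ k xs .{{_ : NonZero (length xs)}} → rotate k xs ≡ rotate (k % length xs) xs
rotate-% k xs = begin
  rotate k xs                           ≡⟨ cong (λ j → rotate j xs) (m≡m%n+[m/n]*n k n) ⟩
  rotate (r + (k / n) * n) xs           ≡⟨ rotate-+ r ((k / n) * n) xs ⟩
  rotate ((k / n) * n) (rotate r xs)    ≡⟨ cong (λ m → rotate ((k / n) * m) (rotate r xs)) (sym (length-rotate r xs)) ⟩
  rotate ((k / n) * length (rotate r xs)) (rotate r xs) ≡⟨ rotate-*-length (k / n) (rotate r xs) ⟩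
  rotate r xs                           ∎
  where
  open ≡-Reasoning
  n = length xs
  r = k % n

reverse-rotate : ∀ k xs → ∃[ j ] (reverse (rotate k xs) ≡ rotate j (reverse xs))
reverse-rotate zero    xs       = 0 , refl
reverse-rotate (suc k) []       = 0 , cong reverse (rotate-[] (suc k))
reverse-rotate (suc k) (x ∷ xs) with reverse-rotate k (xs ∷ʳ x)
... | j , eq = length (reverse xs) + j , (begin
  reverse (rotate k (xs ∷ʳ x))              ≡⟨ eq ⟩
  rotate j (reverse (xs ∷ʳ x))              ≡⟨ cong (rotate j) (reverse-++ xs [ x ]) ⟩
  rotate j (x ∷ reverse xs)                 ≡⟨ cong (rotate j) (sym (rotate-++ (reverse xs) [ x ])) ⟩
  rotate j (rotate (length (reverse xs)) (reverse xs ∷ʳ x)) ≡⟨ sym (rotate-+ (length (reverse xs)) j (reverse xs ∷ʳ x)) ⟩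
  rotate (length (reverse xs) + j) (reverse xs ∷ʳ x)     ≡⟨ cong (rotate (length (reverse xs) + j)) (sym (unfold-reverse x xs)) ⟩
  rotate (length (reverse xs) + j) (reverse (x ∷ xs))    ∎)
  where open ≡-Reasoning

rotate-factor-to-end : ∀ u I v → rotate (length (u ++ I)) (u ++ I ++ v) ≡ (v ++ u) ++ I
rotate-factor-to-end u I v = begin
  rotate (length (u ++ I)) (u ++ I ++ v)   ≡⟨ cong (rotate (length (u ++ I))) (sym (++-assoc u I v)) ⟩
  rotate (length (u ++ I)) ((u ++ I) ++ v) ≡⟨ rotate-++ (u ++ I) v ⟩
  v ++ u ++ I                              ≡⟨ sym (++-assoc v u I) ⟩
  (v ++ u) ++ I                            ∎
  where open ≡-Reasoning

record Block : Set where
  constructor block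
  field
    b₁ b₂ : F4
    bs    : List F4
    bₗ    : F4

  interior : List F4
  interior = b₂ ∷ bs

  quiddity : List F4
  quiddity = b₁ ∷ (interior ∷ʳ bₗ)

open Block

length-quiddity : ∀ t → 3 ≤ length (quiddity t)
length-quiddity (block _ _ bs bₗ) = subst (λ n → 3 ≤ suc (suc n)) (sym (length-∷ʳ bs bₗ)) (s≤s (s≤s (s≤s z≤n)))

insertAt : ∀ {A : Set} → ℕ → A → List A → List A
insertAt n z xs = take n xs ++ z ∷ drop n xs

⊕-pair : ∀ x y b₁ b₂ bs bₗ → (x ∷ y ∷ []) ⊕ quiddity (block b₁ b₂ bs bₗ) ≡ (x +F bₗ) ∷ (y +F b₁) ∷ b₂ ∷ bs
⊕-pair x y b₁ b₂ []       bₗ = refl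
⊕-pair x y b₁ b₂ (c ∷ cs) bₗ = cong (insertAt 2 b₂) (⊕-pair x y b₁ c cs bₗ)

⊕-insertAt₁ : ∀ x z zs y t →
  (x ∷ z ∷ (zs ∷ʳ y)) ⊕ quiddity t ≡ insertAt 1 z ((x ∷ (zs ∷ʳ y)) ⊕ quiddity t)
⊕-insertAt₁ x z []      y t = refl
⊕-insertAt₁ x z (_ ∷ _) y t = refl

⊕-split : ∀ x q y t → (x ∷ (q ∷ʳ y)) ⊕ quiddity t ≡ (x +F bₗ t) ∷ q ++ (y +F b₁ t) ∷ interior t
⊕-split x []       y (block b₁ b₂ bs bₗ) = ⊕-pair x y b₁ b₂ bs bₗ
⊕-split x (z ∷ zs) y t = trans (⊕-insertAt₁ x z zs y t) (cong (insertAt 1 z) (⊕-split x zs y t))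

⊕-complement : ∀ x q y t → ((x +F bₗ t) ∷ (q ∷ʳ (y +F b₁ t))) ⊕ quiddity t ≡ (x ∷ (q ∷ʳ y)) ++ interior t
⊕-complement x q y t = begin
  ((x +F bₗ t) ∷ (q ∷ʳ (y +F b₁ t))) ⊕ quiddity t           ≡⟨ ⊕-split (x +F bₗ t) q (y +F b₁ t) t ⟩
  (x +F bₗ t +F bₗ t) ∷ q ++ (y +F b₁ t +F b₁ t) ∷ interior t ≡⟨ cong₂ (λ u v → u ∷ q ++ v ∷ interior t) (+F-cancelʳ x (bₗ t)) (+F-cancelʳ y (b₁ t)) ⟩
  x ∷ q ++ y ∷ interior t                                    ≡⟨ cong (x ∷_) (sym (++-assoc q [ y ] (interior t))) ⟩
  (x ∷ (q ∷ʳ y)) ++ interior t                               ∎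
  where open ≡-Reasoning

⊕-decompose : ∀ a b → 3 ≤ length a → 3 ≤ length b →
  ∃[ t ] ∃[ P ] (b ≡ quiddity t × a ⊕ b ≡ P ++ interior t × 3 ≤ length P)
⊕-decompose (a₁ ∷ as) (b₁ ∷ b₂ ∷ bs) la lb with initLast as | initLast bs
⊕-decompose (a₁ ∷ _) (_ ∷ _ ∷ _) (s≤s ()) lb | [] | _
⊕-decompose (a₁ ∷ _) (_ ∷ _ ∷ _) la (s≤s (s≤s ())) | _ ∷ʳ′ _ | []
⊕-decompose (a₁ ∷ _) (b₁ ∷ b₂ ∷ _) la lb | q ∷ʳ′ y | cs ∷ʳ′ bₗ =
  t , P , refl ,
  trans (⊕-split a₁ q y t) (cong ((a₁ +F bₗ) ∷_) (sym (++-assoc q [ y +F b₁ ] (interior t)))) ,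
  subst (3 ≤_) (length-ends a₁ (a₁ +F bₗ) q y (y +F b₁)) la
  where
  t = block b₁ b₂ cs bₗ
  P = (a₁ +F bₗ) ∷ (q ∷ʳ (y +F b₁))
⊕-decompose (_ ∷ _)  (_ ∷ [])    _       (s≤s ())

factor⇒reducible : ∀ c k P t → rotate k c ≡ P ++ interior t → 3 ≤ length P →
  IsλQuiddity (quiddity t) → IsReducible c
factor⇒reducible c k (p ∷ ps) t eq lP Qt with initLast ps
factor⇒reducible c k (p ∷ _) t eq (s≤s ()) Qt | []
factor⇒reducible c k (p ∷ _) t eq lP Qt | q ∷ʳ′ y =
  inj₂ (lc , a , quiddity t , la , length-quiddity t , Qt , k , inj₁ (trans (⊕-complement p q y t) (sym eq)))
  where
  a = (p +F bₗ t) ∷ (q ∷ʳ (y +F b₁ t))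
  la : 3 ≤ length a
  la = subst (3 ≤_) (length-ends p (p +F bₗ t) q y (y +F b₁ t)) lP
  lc : 3 ≤ length c
  lc = begin
    3                                   ≤⟨ lP ⟩
    length (p ∷ (q ∷ʳ y))               ≤⟨ length-++-≤ˡ (p ∷ (q ∷ʳ y)) ⟩
    length ((p ∷ (q ∷ʳ y)) ++ interior t) ≡⟨ cong length (sym eq) ⟩
    length (rotate k c)                 ≡⟨ length-rotate k c ⟩
    length c                            ∎
    where open ≤-Reasoning

blocks : List Block
blocks =
    block 1̄   1̄   []                                     1̄
  ∷ block 0̄   X+1̄ (0̄ ∷ [])                               X+1̄
  ∷ block X+1̄ 0̄   (X+1̄ ∷ [])                             0̄
  ∷ block 0̄   0̄   (0̄ ∷ [])                               0̄
  ∷ block X   0̄   (X ∷ [])                               0̄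
  ∷ block 0̄   X   (0̄ ∷ [])                               X
  ∷ block X   X   (X ∷ X ∷ [])                           X
  ∷ block X+1̄ X+1̄ (X+1̄ ∷ X+1̄ ∷ [])                       X+1̄
  ∷ block X   X+1̄ (X ∷ X+1̄ ∷ X ∷ [])                     X+1̄
  ∷ block X+1̄ X   (X+1̄ ∷ X ∷ X+1̄ ∷ [])                   X
  ∷ block X   X+1̄ (X+1̄ ∷ X ∷ X ∷ X+1̄ ∷ X+1̄ ∷ [])         X
  ∷ block X   X   (X+1̄ ∷ X+1̄ ∷ X ∷ X ∷ X+1̄ ∷ [])         X+1̄
  ∷ block X+1̄ X   (X ∷ X+1̄ ∷ X+1̄ ∷ X ∷ X ∷ [])           X+1̄
  ∷ block X+1̄ X+1̄ (X ∷ X ∷ X+1̄ ∷ X+1̄ ∷ X ∷ [])           X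
  ∷ block X+1̄ X+1̄ (X ∷ X+1̄ ∷ X+1̄ ∷ X ∷ X+1̄ ∷ X+1̄ ∷ [])   X
  ∷ block X+1̄ X   (X+1̄ ∷ X+1̄ ∷ X ∷ X+1̄ ∷ X+1̄ ∷ X ∷ [])   X+1̄
  ∷ block X   X+1̄ (X+1̄ ∷ X ∷ X+1̄ ∷ X+1̄ ∷ X ∷ X+1̄ ∷ [])   X+1̄
  ∷ block X+1̄ X   (X ∷ X+1̄ ∷ X ∷ X ∷ X+1̄ ∷ X ∷ [])       X
  ∷ block X   X+1̄ (X ∷ X ∷ X+1̄ ∷ X ∷ X ∷ X+1̄ ∷ [])       X
  ∷ block X   X   (X+1̄ ∷ X ∷ X ∷ X+1̄ ∷ X ∷ X ∷ [])       X+1̄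
  ∷ []

blocks-λQuiddity : All (IsλQuiddity ∘ quiddity) blocks
blocks-λQuiddity = fromYes (all? (isλQuiddity? ∘ quiddity) blocks) refl

HasBlockFactor : List F4 → Set
HasBlockFactor w = Any (λ t → length (interior t) + 3 ≤ length w × Infix _≡_ (interior t) w) blocks

hasBlockFactor? : Decidable HasBlockFactor
hasBlockFactor? w =
  any? (λ t → (length (interior t) + 3 ≤? length w) ×-dec infix? _≟F_ (interior t) w) blocks

length-outside : ∀ {A : Set} (u I v : List A) → length I + 3 ≤ length (u ++ I ++ v) → 3 ≤ length (v ++ u)
length-outside u I v long =
  subst (3 ≤_) (sym (length-++ v)) (+-cancelˡ-≤ (length I) 3 _ (subst (length I + 3 ≤_) regroup long))
  where
  open ≡-Reasoning
  regroup : length (u ++ I ++ v) ≡ length I + (length v + length u)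
  regroup = begin
    length (u ++ I ++ v)                 ≡⟨ length-++ u ⟩
    length u + length (I ++ v)           ≡⟨ cong (length u +_) (length-++ I) ⟩
    length u + (length I + length v)     ≡⟨ +-comm (length u) _ ⟩
    (length I + length v) + length u     ≡⟨ +-assoc (length I) _ _ ⟩
    length I + (length v + length u)     ∎

blockFactor⇒reducible : ∀ c i w r → rotate i c ≡ w ++ r → HasBlockFactor w → IsReducible c
blockFactor⇒reducible c i w r eq has with find has
... | t , t∈blocks , long , occurs with infix⇒split occurs
... | u , v , refl =
  factor⇒reducible c (i + length (u ++ interior t)) ((v ++ r) ++ u) t rotated
    (length-outside u (interior t) (v ++ r) (≤-trans long longer))
    (All.lookup blocks-λQuiddity t∈blocks)
  where
  open ≡-Reasoning
  reassociate : (u ++ interior t ++ v) ++ r ≡ u ++ interior t ++ v ++ r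
  reassociate = trans (++-assoc u _ r) (cong (u ++_) (++-assoc (interior t) v r))
  longer : length (u ++ interior t ++ v) ≤ length (u ++ interior t ++ v ++ r)
  longer = subst (length (u ++ interior t ++ v) ≤_) (cong length reassociate)
                 (length-++-≤ˡ (u ++ interior t ++ v))
  rotated : rotate (i + length (u ++ interior t)) c ≡ ((v ++ r) ++ u) ++ interior t
  rotated = begin
    rotate (i + length (u ++ interior t)) c                  ≡⟨ rotate-+ i _ c ⟩
    rotate (length (u ++ interior t)) (rotate i c)           ≡⟨ cong (rotate (length (u ++ interior t))) eq ⟩
    rotate (length (u ++ interior t)) ((u ++ interior t ++ v) ++ r)
                                                   ≡⟨ cong (rotate (length (u ++ interior t))) reassociate ⟩
    rotate (length (u ++ interior t)) (u ++ interior t ++ v ++ r)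
                                                   ≡⟨ rotate-factor-to-end u (interior t) (v ++ r) ⟩
    ((v ++ r) ++ u) ++ interior t                  ∎

Listed : List F4 → Set
Listed c = ∃[ q ] ∃[ k ] (q ∈ irreducibleList × c ≡ rotate k q)

ListedIfIrreducible : List F4 → Set
ListedIfIrreducible c = IsIrreducibleλQuiddity c → Listed c

Classified : List F4 → Set
Classified w =
  length w < 3 ⊎ ¬ IsλQuiddity w
  ⊎ Any (λ q → Any (λ i → w ≡ rotate i q) (upTo (length q))) irreducibleList
  ⊎ Any (λ i → HasBlockFactor (rotate i w)) (upTo (length w))

classified? : Decidable Classified
classified? w =
  length w <? 3 ⊎-dec ¬? (isλQuiddity? w)
  ⊎-dec any? (λ q → any? (λ i → ≡-dec _≟F_ w (rotate i q)) (upTo (length q))) irreducibleList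
  ⊎-dec any? (λ i → hasBlockFactor? (rotate i w)) (upTo (length w))

classified⇒listedIfIrreducible : ∀ w → Classified w → ListedIfIrreducible w
classified⇒listedIfIrreducible w (inj₁ short) (_ , long , _) = contradiction long (<⇒≱ short)
classified⇒listedIfIrreducible w (inj₂ (inj₁ notλQuiddity)) (λQuiddity , _) =
  contradiction λQuiddity notλQuiddity
classified⇒listedIfIrreducible w (inj₂ (inj₂ (inj₁ listed))) _ with find listed
... | q , q∈list , rotation = let i , w≡ = Any.satisfied rotation in q , i , q∈list , w≡
classified⇒listedIfIrreducible w (inj₂ (inj₂ (inj₂ factor))) (_ , _ , irreducible) =
  let i , has = Any.satisfied factor in
  contradiction (blockFactor⇒reducible w i (rotate i w) [] (sym (++-identityʳ _)) has) irreducible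

blockFactor⇒listedIfIrreducible : ∀ w r → HasBlockFactor w → ListedIfIrreducible (w ++ r)
blockFactor⇒listedIfIrreducible w r has (_ , _ , irreducible) =
  contradiction (blockFactor⇒reducible (w ++ r) 0 w r refl has) irreducible

-- Depth-first search through all words, cut as soon as the prefix has a block factor;
-- every branch is cut by length 10.
explore : ℕ → List F4 → Bool
explore zero    w = ⌊ hasBlockFactor? w ⌋
explore (suc n) w =
  ⌊ hasBlockFactor? w ⌋ ∨ (⌊ classified? w ⌋ ∧ all (λ x → explore n (w ∷ʳ x)) F4-elements)

explore-sound : ∀ n w → explore n w ≡ true → ∀ r → ListedIfIrreducible (w ++ r)
explore-sound zero    w found r = blockFactor⇒listedIfIrreducible w r (fromYes (hasBlockFactor? w) found)
explore-sound (suc n) w found r =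
  [ (λ factor → blockFactor⇒listedIfIrreducible w r (toWitness factor))
  , (λ branch → extend r (Equivalence.to T-∧ branch))
  ]′ (Equivalence.to T-∨ (Equivalence.from T-≡ found))
  where
  extend : ∀ r → T ⌊ classified? w ⌋ × T (all (λ x → explore n (w ∷ʳ x)) F4-elements) →
           ListedIfIrreducible (w ++ r)
  extend []      (classified , _) = subst ListedIfIrreducible (sym (++-identityʳ w))
                                      (classified⇒listedIfIrreducible w (toWitness classified))
  extend (x ∷ r) (_ , explored) = subst ListedIfIrreducible (++-assoc w [ x ] r)
                                      (explore-sound n (w ∷ʳ x) (Equivalence.to T-≡ (explored-at x)) r)
    where
    explored-at : ∀ x → T (explore n (w ∷ʳ x))
    explored-at x = All.lookup (all⁺ (λ x → explore n (w ∷ʳ x)) F4-elements explored) (∈-F4-elements x)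

explore-complete : explore 10 [] ≡ true
explore-complete = refl

AllRotations : (List F4 → Set) → List F4 → Set
AllRotations P q = All (λ i → P (rotate i q)) (upTo (length q))

allRotations-sound : ∀ P q → 0 < length q → AllRotations P q → ∀ k → P (rotate k q)
allRotations-sound P q nonEmpty rotations k =
  subst P (sym (rotate-% k q)) (All.lookup rotations (∈-upTo⁺ (m%n<n k (length q))))
  where instance _ = >-nonZero nonEmpty

-- By ⊕-decompose, a ⊕ b = r with b a λ-quiddity would make drop i r, for some i ≥ 3,
-- the interior of b.
Unsplittable : List F4 → Set
Unsplittable r =
  All (λ i → 3 ≤ i → All (λ x → All (λ z → ¬ IsλQuiddity (x ∷ (drop i r ∷ʳ z))) F4-elements) F4-elements)
      (upTo (length r))

unsplittable? : Decidable Unsplittable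
unsplittable? r =
  all? (λ i → (3 ≤? i) →-dec all? (λ x → all? (λ z → ¬? (isλQuiddity? (x ∷ (drop i r ∷ʳ z)))) F4-elements) F4-elements)
       (upTo (length r))

unsplittable⇒≢⊕ : ∀ r a b → Unsplittable r → 3 ≤ length a → 3 ≤ length b → IsλQuiddity b → a ⊕ b ≢ r
unsplittable⇒≢⊕ r a b unsplittable la lb λQuiddity eq with ⊕-decompose a b la lb
... | t , P , refl , split , lP =
  All.lookup (All.lookup (All.lookup unsplittable (∈-upTo⁺ P<r) lP) (∈-F4-elements (b₁ t))) (∈-F4-elements (bₗ t))
    (subst (λ m → IsλQuiddity (b₁ t ∷ (m ∷ʳ bₗ t))) (sym interior≡) λQuiddity)
  where
  r≡ : r ≡ P ++ interior t
  r≡ = trans (sym eq) split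
  interior≡ : drop (length P) r ≡ interior t
  interior≡ = trans (cong (drop (length P)) r≡) (drop-length-++ P (interior t))
  P<r : length P < length r
  P<r = subst (length P <_) (sym (trans (cong length r≡) (length-++ P))) (m<m+n (length P) z<s)

IrreducibleShape : List F4 → Set
IrreducibleShape q =
  3 ≤ length q × AllRotations IsλQuiddity q × AllRotations Unsplittable q × AllRotations Unsplittable (reverse q)

irreducibleShape? : Decidable IrreducibleShape
irreducibleShape? q =
  3 ≤? length q
  ×-dec all? (λ i → isλQuiddity? (rotate i q)) (upTo (length q))
  ×-dec all? (λ i → unsplittable? (rotate i q)) (upTo (length q))
  ×-dec all? (λ i → unsplittable? (rotate i (reverse q))) (upTo (length (reverse q)))

irreducibleList-shape : All IrreducibleShape irreducibleList
irreducibleList-shape = fromYes (all? irreducibleShape? irreducibleList) refl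

irreducibleShape⇒irreducible : ∀ q → IrreducibleShape q → ∀ k → IsIrreducibleλQuiddity (rotate k q)
irreducibleShape⇒irreducible q (long , λQuiddities , unsplittable , unsplittableʳ) k =
  allRotations-sound IsλQuiddity q nonEmpty λQuiddities k , long′ , irreducible
  where
  nonEmpty : 0 < length q
  nonEmpty = ≤-trans (s≤s z≤n) long
  long′ : 3 ≤ length (rotate k q)
  long′ = subst (3 ≤_) (sym (length-rotate k q)) long
  irreducible : ¬ IsReducible (rotate k q)
  irreducible (inj₁ ≡00) = contradiction (subst (λ c → 3 ≤ length c) ≡00 long′) λ { (s≤s (s≤s ())) }
  irreducible (inj₂ (_ , a , b , la , lb , λQuiddity , j , inj₁ eq)) =
    unsplittable⇒≢⊕ _ a b (allRotations-sound Unsplittable q nonEmpty unsplittable (k + j)) la lb λQuiddity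
      (trans eq (sym (rotate-+ k j q)))
  irreducible (inj₂ (_ , a , b , la , lb , λQuiddity , j , inj₂ eq)) with reverse-rotate k q
  ... | m , reversed =
    unsplittable⇒≢⊕ _ a b
      (allRotations-sound Unsplittable (reverse q) (subst (0 <_) (sym (length-reverse q)) nonEmpty) unsplittableʳ (m + j))
      la lb λQuiddity (trans eq (trans (cong (rotate j) reversed) (sym (rotate-+ m j (reverse q)))))

irreducible⇒listed : ∀ c → IsIrreducibleλQuiddity c → Listed c
irreducible⇒listed = explore-sound 10 [] explore-complete

listed⇒irreducible : ∀ c → Listed c → IsIrreducibleλQuiddity c
listed⇒irreducible _ (q , k , q∈list , refl) =
  irreducibleShape⇒irreducible q (All.lookup irreducibleList-shape q∈list) k

mainTheorem3 : (c : List F4) →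
    (IsIrreducibleλQuiddity c → ∃[ q ] ∃[ k ] (q ∈ irreducibleList × c ≡ rotate k q))
    × (∃[ q ] ∃[ k ] (q ∈ irreducibleList × c ≡ rotate k q) → IsIrreducibleλQuiddity c)
mainTheorem3 c = irreducible⇒listed c , listed⇒irreducible c
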